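{- Let $V=\{1,\dots,n\}$, let $0<\lambda_1<\cdots<\lambda_k\le n$ be integers with $\lambda_{i+1}-\lambda_i\le\lambda_1$ for all $i=1,\dots,k-1$ and $\lambda_1+\lambda_k=n$, and let $\mathcal H=\bigcup_{j=1}^k\binom{V}{\lambda_j}$. Then for every position $x\in\mathbb Z_{\ge0}^V$ and every integer $\eta$ with $1\le\eta<y_{\mathcal H}(x)$ there exists a move $x\to x'$ in $NIM_{\mathcal H}$ such that $m(x')=m(x)$ and $y_{\mathcal H}(x')=\eta$.
   Context: $\binom{V}{t}$ is the family of $t$-element subsets of $V$. Hypergraph NIM $NIM_{\mathcal H}$: positions are $x\in\mathbb Z_{\ge0}^V$; a move $x\to x'$ chooses $H\in\mathcal H$ and strictly decreases every coordinate $x_i$, $i\in H$ (to nonnegative values), leaving the other coordinates unchanged. The Tetris value $\mathcal T_{\mathcal H}(x)$ is the maximum number of consecutive moves that can be made starting from $x$. With $e$ the all-ones vector, $m(x)=\min_{i\in V}x_i$ and $y_{\mathcal H}(x)=\mathcal T_{\mathcal H}(x-m(x)e)+1$. -}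

module Defs where

open import Data.Nat using (ℕ; zero; suc; _+_; _∸_; _≤_; _<_; _⊓_)
open import Data.Fin using (Fin; zero; suc; inject₁; fromℕ)
open import Data.Fin.Subset using (Subset; _∈_; _∉_; ∣_∣)
open import Data.Product using (Σ; ∃; _×_)
open import Relation.Binary.PropositionalEquality using (_≡_)

Position : ℕ → Set
Position n = Fin n → ℕ

-- m(x) = min_{i ∈ V} x_i  (convention: 0 when V is empty; never used, n ≥ 2 in the lemma)
minPos : ∀ {n} → Position n → ℕ
minPos {zero} x = 0
minPos {suc zero} x = x zero
minPos {suc (suc n)} x = x zero ⊓ minPos (λ i → x (suc i))

subConst : ∀ {n} → Position n → ℕ → Position n
subConst x c i = x i ∸ c

Hypergraph : ℕ → Set₁
Hypergraph n = Subset n → Set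

UnionOfLevels : ∀ {n k} → (Fin k → ℕ) → Hypergraph n
UnionOfLevels lam E = ∃ λ j → ∣ E ∣ ≡ lam j

Move : ∀ {n} → Hypergraph n → Position n → Position n → Set
Move {n} H x x' = Σ (Subset n) λ E → H E ×
  ((i : Fin n) → (i ∈ E → x' i < x i) × (i ∉ E → x' i ≡ x i))

data Play {n} (H : Hypergraph n) : Position n → ℕ → Set where
  done : ∀ {x} → Play H x 0
  step : ∀ {x x' t} → Move H x x' → Play H x' t → Play H x (suc t)

IsTetris : ∀ {n} → Hypergraph n → Position n → ℕ → Set
IsTetris H x t = Play H x t × (∀ s → Play H x s → s ≤ t)

IsY : ∀ {n} → Hypergraph n → Position n → ℕ → Set
IsY H x y = Σ ℕ λ t → IsTetris H (subConst x (minPos x)) t × y ≡ suc t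

module Submission where

-- Write z = x − m(x)e for the normalised position, so that z i₀ = 0 for some vertex i₀,
-- and let v = η − 1 < T(z).  The first move of a longest play from z reaches a position
-- that still admits v moves; we then walk, inside the set of positions reachable from z in
-- one move, towards a position w with T(w) = v exactly.  If w admits v + 1 moves we lower
-- it, keeping it one move away from z and keeping v moves available:
--   * if the edge E of the move z → w has a positive coordinate of w, lower that coordinate
--     by one (decreasing one coordinate by one costs at most one move);
--   * otherwise w vanishes on E, so the first move F of a play of length v + 1 from w is
--     disjoint from E, and i₀ ∉ E ∪ F; for the level hypergraph H this allows to enlarge
--     E by a nonempty A ⊆ F to an edge E ∪ A ("extendability"), and lowering w on A is
--     dominated by the move along F.
-- The total weight of w decreases, so the walk terminates.

open import Defs
open import Data.Nat using (ℕ; zero; suc; pred; _+_; _∸_; _≤_; _<_; _⊓_; z≤n; s≤s; _≤?_; _<?_; s≤s⁻¹; _≟_)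
open import Data.Nat.Properties
open import Data.Nat.Induction using (<-wellFounded)
open import Data.Bool using (true; false)
open import Data.Fin using (Fin; zero; suc; inject₁; fromℕ)
open import Data.Fin.Properties using (any?; all?)
open import Data.Fin.Subset using (Subset; _∈_; _∉_; ∣_∣; _∪_; _⊆_; ⁅_⁆; ⊥; Nonempty)
open import Data.Fin.Subset.Properties
  using (_∈?_; anySubset?; nonempty?; Empty-unique; ∣⊥∣≡0; ⊥⊆; ∈⊤; ⊆⊤; ∣⊤∣≡n; p⊂q⇒∣p∣<∣q∣;
         x∈p∪q⁻; x∈p∪q⁺; x∈⁅x⁆; x∈⁅y⁆⇒x≡y)
open import Data.Vec using ([]; _∷_; here; there)
open import Data.Product using (∃; _×_; _,_; proj₁; proj₂)
open import Data.Sum using (_⊎_; inj₁; inj₂; [_,_])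
open import Function using (_∘_)
open import Induction.WellFounded using (Acc; acc)
open import Relation.Nullary using (Dec; yes; no; ¬_; contradiction)
open import Relation.Nullary.Decidable using (map′; _×-dec_; _→-dec_)
open import Relation.Binary.PropositionalEquality using (_≡_; refl; sym; trans; cong; cong₂; subst; module ≡-Reasoning)

Disjoint : ∀ {n} → Subset n → Subset n → Set
Disjoint {n} p q = ∀ {i : Fin n} → i ∈ p → i ∉ q

missing⇒∣p∣<n : ∀ {n} (p : Subset n) {i : Fin n} → i ∉ p → ∣ p ∣ < n
missing⇒∣p∣<n {n} p {i} i∉p = subst (∣ p ∣ <_) (∣⊤∣≡n n) (p⊂q⇒∣p∣<∣q∣ (⊆⊤ , i , ∈⊤ , i∉p))

∣∪∣-disjoint : ∀ {n} (p q : Subset n) → Disjoint p q → ∣ p ∪ q ∣ ≡ ∣ p ∣ + ∣ q ∣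
∣∪∣-disjoint []           []           _    = refl
∣∪∣-disjoint (true  ∷ p) (true  ∷ q) disj = contradiction here (disj here)
∣∪∣-disjoint (true  ∷ p) (false ∷ q) disj = cong suc (∣∪∣-disjoint p q (λ i∈p → disj (there i∈p) ∘ there))
∣∪∣-disjoint (false ∷ p) (true  ∷ q) disj =
  trans (cong suc (∣∪∣-disjoint p q (λ i∈p → disj (there i∈p) ∘ there))) (sym (+-suc ∣ p ∣ ∣ q ∣))
∣∪∣-disjoint (false ∷ p) (false ∷ q) disj = ∣∪∣-disjoint p q (λ i∈p → disj (there i∈p) ∘ there)

subset-of-size : ∀ {n} (F : Subset n) (d : ℕ) → d ≤ ∣ F ∣ → ∃ λ A → A ⊆ F × ∣ A ∣ ≡ d
subset-of-size {n} F zero _ = ⊥ , ⊥⊆ , ∣⊥∣≡0 n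
subset-of-size (true ∷ F) (suc d) d<∣F∣ with subset-of-size F d (s≤s⁻¹ d<∣F∣)
... | A , A⊆F , ∣A∣≡d = true ∷ A , (λ { here → here ; (there i∈A) → there (A⊆F i∈A) }) , cong suc ∣A∣≡d
subset-of-size (false ∷ F) (suc d) d<∣F∣ with subset-of-size F (suc d) d<∣F∣
... | A , A⊆F , ∣A∣≡d = false ∷ A , (λ { (there i∈A) → there (A⊆F i∈A) }) , ∣A∣≡d

on-singleton : ∀ {n} (P : Fin n → Set) {i : Fin n} → P i → ∀ {j} → j ∈ ⁅ i ⁆ → P j
on-singleton P {i} Pi j∈⁅i⁆ = subst P (sym (x∈⁅y⁆⇒x≡y i j∈⁅i⁆)) Pi

∣p∣>0⇒nonempty : ∀ {n} (p : Subset n) → 0 < ∣ p ∣ → Nonempty p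
∣p∣>0⇒nonempty {n} p ∣p∣>0 with nonempty? p
... | yes ne    = ne
... | no empty = contradiction (trans (cong ∣_∣ (Empty-unique empty)) (∣⊥∣≡0 n)) (n>0⇒n≢0 ∣p∣>0)

-- An edge E can be grown inside any disjoint edge F into an edge, provided E ∪ F misses a
-- vertex.  This is the only property of H that the walk towards T(w) = v uses.
Extendable : ∀ {n} → Hypergraph n → Set
Extendable {n} H = ∀ {E F} → H E → H F → Disjoint E F → (i : Fin n) → i ∉ E → i ∉ F →
  ∃ λ A → A ⊆ F × Nonempty A × H (E ∪ A)

last-or-inject₁ : ∀ {k} (j : Fin (suc k)) → j ≡ fromℕ k ⊎ ∃ λ j' → j ≡ inject₁ j'
last-or-inject₁ {zero}  zero    = inj₁ refl
last-or-inject₁ {suc k} zero    = inj₂ (zero , refl)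
last-or-inject₁ {suc k} (suc j) with last-or-inject₁ j
... | inj₁ j≡last     = inj₁ (cong suc j≡last)
... | inj₂ (j' , j≡j') = inj₂ (suc j' , cong suc j≡j')

first-level-min : ∀ {k} (lam : Fin (suc k) → ℕ) → ((i : Fin k) → lam (inject₁ i) < lam (suc i)) →
  ∀ j → lam zero ≤ lam j
first-level-min lam inc zero = ≤-refl
first-level-min {suc k} lam inc (suc j) =
  ≤-trans (first-level-min (lam ∘ inject₁) (inc ∘ inject₁) j) (<⇒≤ (inc j))

-- The level hypergraph is extendable: the top level cannot occur for E (then |E| + |F| ≥
-- λₖ + λ₁ = n), and from level λⱼ we reach λⱼ₊₁ by adding λⱼ₊₁ − λⱼ ≤ λ₁ ≤ |F| vertices of F.
levels-extendable : ∀ {n k} (lam : Fin (suc k) → ℕ) →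
  ((i : Fin k) → lam (inject₁ i) < lam (suc i)) →
  ((i : Fin k) → lam (suc i) ≤ lam (inject₁ i) + lam zero) →
  lam zero + lam (fromℕ k) ≡ n →
  Extendable {n} (UnionOfLevels lam)
levels-extendable {n} {k} lam inc gap total {E} {F} (j , ∣E∣≡) (l , ∣F∣≡) disj i i∉E i∉F
  with last-or-inject₁ j
... | inj₁ refl = contradiction n≤∣E∣+∣F∣ (<⇒≱ ∣E∣+∣F∣<n)
  where
  ∣E∣+∣F∣<n : ∣ E ∣ + ∣ F ∣ < n
  ∣E∣+∣F∣<n = subst (_< n) (∣∪∣-disjoint E F disj)
    (missing⇒∣p∣<n (E ∪ F) ([ i∉E , i∉F ] ∘ x∈p∪q⁻ E F))
  n≤∣E∣+∣F∣ : n ≤ ∣ E ∣ + ∣ F ∣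
  n≤∣E∣+∣F∣ = begin
    n                          ≡⟨ sym total ⟩
    lam zero + lam (fromℕ k)   ≡⟨ +-comm (lam zero) _ ⟩
    lam (fromℕ k) + lam zero   ≤⟨ +-monoʳ-≤ _ (first-level-min lam inc l) ⟩
    lam (fromℕ k) + lam l      ≡⟨ sym (cong₂ _+_ ∣E∣≡ ∣F∣≡) ⟩
    ∣ E ∣ + ∣ F ∣              ∎
    where open ≤-Reasoning
... | inj₂ (j' , refl) = A , A⊆F , ∣p∣>0⇒nonempty A (subst (0 <_) (sym ∣A∣≡) (m<n⇒0<n∸m (inc j'))) ,
                          suc j' , ∣E∪A∣≡
  where
  step≤∣F∣ : lam (suc j') ∸ lam (inject₁ j') ≤ ∣ F ∣
  step≤∣F∣ = ≤-trans (m≤n+o⇒m∸n≤o _ _ (gap j'))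
                     (subst (lam zero ≤_) (sym ∣F∣≡) (first-level-min lam inc l))
  A : Subset n
  A = proj₁ (subset-of-size F _ step≤∣F∣)
  A⊆F : A ⊆ F
  A⊆F = proj₁ (proj₂ (subset-of-size F _ step≤∣F∣))
  ∣A∣≡ : ∣ A ∣ ≡ lam (suc j') ∸ lam (inject₁ j')
  ∣A∣≡ = proj₂ (proj₂ (subset-of-size F _ step≤∣F∣))
  ∣E∪A∣≡ : ∣ E ∪ A ∣ ≡ lam (suc j')
  ∣E∪A∣≡ = begin
    ∣ E ∪ A ∣                                              ≡⟨ ∣∪∣-disjoint E A (λ i∈E → disj i∈E ∘ A⊆F) ⟩
    ∣ E ∣ + ∣ A ∣                                           ≡⟨ cong₂ _+_ ∣E∣≡ ∣A∣≡ ⟩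
    lam (inject₁ j') + (lam (suc j') ∸ lam (inject₁ j'))   ≡⟨ m+[n∸m]≡n (<⇒≤ (inc j')) ⟩
    lam (suc j')                                           ∎
    where open ≡-Reasoning

Decrease : ∀ {n} → Subset n → Position n → Position n → Set
Decrease {n} E x x' = (i : Fin n) → (i ∈ E → x' i < x i) × (i ∉ E → x' i ≡ x i)

Positive : ∀ {n} → Position n → Subset n → Set
Positive x A = ∀ i → i ∈ A → 0 < x i

lower : ∀ {n} → Position n → Subset n → Position n
lower x A i with i ∈? A
... | yes _ = pred (x i)
... | no  _ = x i

weight : ∀ {n} → Position n → ℕ
weight {zero}  x = 0
weight {suc n} x = x zero + weight (x ∘ suc)

pred-< : ∀ {a} → 0 < a → pred a < a
pred-< {suc a} _ = n<1+n a

decrease-≤ : ∀ {n E} {x x' : Position n} → Decrease E x x' → ∀ i → x' i ≤ x i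
decrease-≤ {E = E} dec i with i ∈? E
... | yes i∈E = <⇒≤ (proj₁ (dec i) i∈E)
... | no  i∉E = ≤-reflexive (proj₂ (dec i) i∉E)

lower-decrease : ∀ {n A} {x : Position n} → Positive x A → Decrease A x (lower x A)
lower-decrease {A = A} pos i with i ∈? A
... | yes i∈A = (λ _ → pred-< (pos i i∈A)) , (λ i∉A → contradiction i∈A i∉A)
... | no  i∉A = (λ i∈A → contradiction i∈A i∉A) , (λ _ → refl)

decrease-below-lower : ∀ {n E A} {x x' : Position n} → Decrease E x x' → A ⊆ E →
  ∀ i → x' i ≤ lower x A i
decrease-below-lower {A = A} dec A⊆E i with i ∈? A
... | yes i∈A = <⇒≤pred (proj₁ (dec i) (A⊆E i∈A))
... | no  _   = decrease-≤ dec i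

decrease-lower : ∀ {n E A} {x x' : Position n} → (∀ {i} → i ∈ A → i ∉ E) →
  Decrease E x x' → Decrease E (lower x A) (lower x' A)
decrease-lower {A = A} outside dec i with i ∈? A
... | yes i∈A = (λ i∈E → contradiction i∈E (outside i∈A)) , (λ i∉E → cong pred (proj₂ (dec i) i∉E))
... | no  _   = dec i

decrease-∪ : ∀ {n E A} {x w w' : Position n} → Decrease E x w → Decrease A w w' → Decrease (E ∪ A) x w'
decrease-∪ {E = E} {A} {x} {w} {w'} decE decA i = shrinks , fixed
  where
  shrinks : i ∈ E ∪ A → w' i < x i
  shrinks i∈E∪A with x∈p∪q⁻ E A i∈E∪A
  ... | inj₁ i∈E = ≤-<-trans (decrease-≤ decA i) (proj₁ (decE i) i∈E)
  ... | inj₂ i∈A = <-≤-trans (proj₁ (decA i) i∈A) (decrease-≤ decE i)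
  fixed : i ∉ E ∪ A → w' i ≡ x i
  fixed i∉E∪A = trans (proj₂ (decA i) (i∉E∪A ∘ x∈p∪q⁺ ∘ inj₂)) (proj₂ (decE i) (i∉E∪A ∘ x∈p∪q⁺ ∘ inj₁))

decrease-⊆ : ∀ {n E A} {x w w' : Position n} → Decrease E x w → Decrease A w w' → A ⊆ E → Decrease E x w'
decrease-⊆ decE decA A⊆E i =
    (λ i∈E → ≤-<-trans (decrease-≤ decA i) (proj₁ (decE i) i∈E))
  , (λ i∉E → trans (proj₂ (decA i) (i∉E ∘ A⊆E)) (proj₂ (decE i) i∉E))

decrease-shift : ∀ {n E} {x x' : Position n} (d : Position n) → Decrease E x x' →
  Decrease E (λ i → x i + d i) (λ i → x' i + d i)
decrease-shift d dec i = (λ i∈E → +-monoˡ-< (d i) (proj₁ (dec i) i∈E)) , (λ i∉E → cong (_+ d i) (proj₂ (dec i) i∉E))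

decrease-resp : ∀ {n E} {x y x' : Position n} → (∀ i → x i ≡ y i) → Decrease E x x' → Decrease E y x'
decrease-resp x≡y dec i = (λ i∈E → subst (_ <_) (x≡y i) (proj₁ (dec i) i∈E)) , (λ i∉E → trans (proj₂ (dec i) i∉E) (x≡y i))

weight-mono : ∀ {n} (x y : Position n) → (∀ i → x i ≤ y i) → weight x ≤ weight y
weight-mono {zero}  x y x≤y = z≤n
weight-mono {suc n} x y x≤y = +-mono-≤ (x≤y zero) (weight-mono (x ∘ suc) (y ∘ suc) (x≤y ∘ suc))

weight-strict : ∀ {n} (x y : Position n) → (∀ i → x i ≤ y i) → ∀ i → x i < y i → weight x < weight y
weight-strict {suc n} x y x≤y zero    x<y = +-mono-<-≤ x<y (weight-mono (x ∘ suc) (y ∘ suc) (x≤y ∘ suc))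
weight-strict {suc n} x y x≤y (suc i) x<y = +-mono-≤-< (x≤y zero) (weight-strict (x ∘ suc) (y ∘ suc) (x≤y ∘ suc) i x<y)

decrease-weight : ∀ {n E} {x x' : Position n} → Decrease E x x' → Nonempty E → weight x' < weight x
decrease-weight {x = x} {x'} dec (i , i∈E) = weight-strict x' x (decrease-≤ dec) i (proj₁ (dec i) i∈E)

module Plays {n : ℕ} (H : Hypergraph n) where

  -- Larger positions admit at least as long plays: replay each move shifted by y − x.
  play-mono : ∀ {x y s} → (∀ i → x i ≤ y i) → Play H x s → Play H y s
  play-mono x≤y done = done
  play-mono {x} {y} x≤y (step {x' = x₁} (E , hE , dec) p) =
    step (E , hE , decrease-resp (λ i → m+[n∸m]≡n (x≤y i)) (decrease-shift (λ i → y i ∸ x i) dec))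
         (play-mono (λ i → m≤m+n (x₁ i) (y i ∸ x i)) p)

  play-≤ : ∀ {x s t} → s ≤ t → Play H x t → Play H x s
  play-≤ {s = zero}  _          _          = done
  play-≤ {s = suc s} (s≤s s≤t) (step mv p) = step mv (play-≤ s≤t p)

  -- Decreasing one coordinate by one costs at most one move: either the first move already
  -- uses that coordinate, or it commutes with the lowering.
  play-lower-one : ∀ {x s} → Play H x (suc s) → ∀ i → Play H (lower x ⁅ i ⁆) s
  play-lower-one (step (E , hE , dec) p) i with i ∈? E
  ... | yes i∈E = play-mono (decrease-below-lower dec (on-singleton (_∈ E) i∈E)) p
  play-lower-one {s = zero}  (step _ _) i | no _ = done
  play-lower-one {s = suc s} (step (E , hE , dec) p) i | no i∉E =
    step (E , hE , decrease-lower (on-singleton (_∉ E) i∉E) dec)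
         (play-lower-one p i)

  play-suc⇒greedy : ∀ {x s} → Play H x (suc s) → ∃ λ E → H E × Positive x E × Play H (lower x E) s
  play-suc⇒greedy (step (E , hE , dec) p) =
    E , hE , (λ i i∈E → ≤-<-trans z≤n (proj₁ (dec i) i∈E)) , play-mono (decrease-below-lower dec (λ i∈E → i∈E)) p

  -- By the greedy step, whether s moves are possible is a finite search over edges.
  playable? : (∀ E → Dec (H E)) → ∀ x s → Dec (Play H x s)
  playable? H? x zero    = yes done
  playable? H? x (suc s) =
    map′ (λ (E , hE , pos , p) → step (E , hE , lower-decrease pos) p) play-suc⇒greedy
         (anySubset? (λ E → H? E ×-dec all? (λ i → (i ∈? E) →-dec (0 <? x i)) ×-dec playable? H? (lower x E) s))

  tetris-of-maximal : ∀ {x v} → Play H x v → ¬ Play H x (suc v) → IsTetris H x v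
  tetris-of-maximal {x} {v} p ¬p = p , bound
    where
    bound : ∀ s → Play H x s → s ≤ v
    bound s ps with s ≤? v
    ... | yes s≤v = s≤v
    ... | no  s≰v = contradiction (play-≤ (≰⇒> s≰v) ps) ¬p

  tetris-resp : ∀ {x y t} → (∀ i → x i ≡ y i) → IsTetris H x t → IsTetris H y t
  tetris-resp x≡y (p , max) =
    play-mono (≤-reflexive ∘ x≡y) p , λ s ps → max s (play-mono (≤-reflexive ∘ sym ∘ x≡y) ps)

module Walk {n : ℕ} (H : Hypergraph n) (H? : ∀ E → Dec (H E)) (extendable : Extendable H)
            (z : Position n) (i₀ : Fin n) (z-i₀ : z i₀ ≡ 0) (v : ℕ) where
  open Plays H

  descend : ∀ {w} → Move H z w → Play H w (suc v) →
    ∃ λ w' → Move H z w' × Play H w' v × weight w' < weight w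
  descend {w} (E , hE , dec) p with any? (λ i → (i ∈? E) ×-dec (0 <? w i))
  ... | yes (i , i∈E , w-i>0) =
    lower w ⁅ i ⁆ , (E , hE , decrease-⊆ dec lowering (on-singleton (_∈ E) i∈E)) , play-lower-one p i ,
    decrease-weight lowering (i , x∈⁅x⁆ i)
    where
    lowering : Decrease ⁅ i ⁆ w (lower w ⁅ i ⁆)
    lowering = lower-decrease (λ j → on-singleton (λ j → 0 < w j) w-i>0)
  ... | no vanishes with p
  ... | step (F , hF , decF) p₁ =
    lower w A , (E ∪ A , hE∪A , decrease-∪ dec lowering) , play-mono (decrease-below-lower decF A⊆F) p₁ ,
    decrease-weight lowering A≠∅
    where
    F-positive : Positive w F
    F-positive i i∈F = ≤-<-trans z≤n (proj₁ (decF i) i∈F)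
    i₀∉E : i₀ ∉ E
    i₀∉E i₀∈E = <⇒≱ (proj₁ (dec i₀) i₀∈E) (subst (_≤ _) (sym z-i₀) z≤n)
    i₀∉F : i₀ ∉ F
    i₀∉F i₀∈F = <⇒≱ (F-positive i₀ i₀∈F) (≤-reflexive (trans (proj₂ (dec i₀) i₀∉E) z-i₀))
    extension : ∃ λ A → A ⊆ F × Nonempty A × H (E ∪ A)
    extension = extendable hE hF (λ {i} i∈E i∈F → vanishes (i , i∈E , F-positive i i∈F)) i₀ i₀∉E i₀∉F
    A : Subset n
    A = proj₁ extension
    A⊆F : A ⊆ F
    A⊆F = proj₁ (proj₂ extension)
    A≠∅ : Nonempty A
    A≠∅ = proj₁ (proj₂ (proj₂ extension))
    hE∪A : H (E ∪ A)
    hE∪A = proj₂ (proj₂ (proj₂ extension))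
    lowering : Decrease A w (lower w A)
    lowering = lower-decrease (λ i → F-positive i ∘ A⊆F)

  walk : ∀ {w} → Acc _<_ (weight w) → Move H z w → Play H w v → ∃ λ w' → Move H z w' × IsTetris H w' v
  walk {w} (acc smaller) mv p with playable? H? w (suc v)
  ... | no  ¬p = w , mv , tetris-of-maximal p ¬p
  ... | yes p' with descend mv p'
  ... | w' , mv' , p'' , lighter = walk (smaller lighter) mv' p''

minPos-≤ : ∀ {n} (x : Position (suc n)) i → minPos x ≤ x i
minPos-≤ {zero}  x zero    = ≤-refl
minPos-≤ {suc n} x zero    = m⊓n≤m (x zero) _
minPos-≤ {suc n} x (suc i) = ≤-trans (m⊓n≤n (x zero) _) (minPos-≤ (x ∘ suc) i)

minPos-attained : ∀ {n} (x : Position (suc n)) → ∃ λ i → x i ≡ minPos x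
minPos-attained {zero}  x = zero , refl
minPos-attained {suc n} x with ⊓-sel (x zero) (minPos (x ∘ suc))
... | inj₁ first = zero , sym first
... | inj₂ rest with minPos-attained (x ∘ suc)
... | i , x-i≡min = suc i , trans x-i≡min (sym rest)

argmin : ∀ {n} → Position (suc n) → Fin (suc n)
argmin x = proj₁ (minPos-attained x)

normalised-argmin : ∀ {n} (x : Position (suc n)) → subConst x (minPos x) (argmin x) ≡ 0
normalised-argmin x = trans (cong (_∸ minPos x) (proj₂ (minPos-attained x))) (n∸n≡0 (minPos x))

minPos-+ : ∀ {n} (x : Position (suc n)) c → minPos (λ i → x i + c) ≡ minPos x + c
minPos-+ {zero}  x c = refl
minPos-+ {suc n} x c =
  trans (cong ((x zero + c) ⊓_) (minPos-+ (x ∘ suc) c)) (sym (+-distribʳ-⊓ c (x zero) (minPos (x ∘ suc))))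

-- A move from the normalised position x − m(x)e to w, where w has Tetris value t, lifts
-- to the move x → x' = w + m(x)e; since w vanishes where x is minimal, m(x') = m(x) and
-- x' − m(x')e = w, so y(x') = t + 1.
lift-normalised : ∀ {n} (H : Hypergraph (suc n)) (x : Position (suc n)) {w t} →
  Move H (subConst x (minPos x)) w → IsTetris H w t →
  ∃ λ x' → Move H x x' × minPos x' ≡ minPos x × IsY H x' (suc t)
lift-normalised {n} H x {w} {t} (E , hE , dec) tetris-w =
  x' , (E , hE , decrease-resp x-restored (decrease-shift (λ _ → m) dec)) , min-x' ,
  t , tetris-resp (sym ∘ normalised) tetris-w , refl
  where
  open Plays H
  m : ℕ
  m = minPos x
  x' : Position (suc n)
  x' i = w i + m
  x-restored : ∀ i → x i ∸ m + m ≡ x i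
  x-restored i = m∸n+n≡m (minPos-≤ x i)
  w-argmin≡0 : w (argmin x) ≡ 0
  w-argmin≡0 = n≤0⇒n≡0 (≤-trans (decrease-≤ dec (argmin x)) (≤-reflexive (normalised-argmin x)))
  min-x' : minPos x' ≡ m
  min-x' = trans (minPos-+ w m)
                 (cong (_+ m) (n≤0⇒n≡0 (subst (minPos w ≤_) w-argmin≡0 (minPos-≤ w (argmin x)))))
  normalised : ∀ i → subConst x' (minPos x') i ≡ w i
  normalised i = trans (cong (x' i ∸_) min-x') (m+n∸n≡m (w i) m)

-- With z = x − m(x)e and T(z) = t ≥ η, the first move z → w₀ of a longest play leaves
-- w₀ with at least η − 1 moves; walk from w₀ to w with T(w) = η − 1 and lift back.
lemma6 : (n k : ℕ) (lam : Fin (suc k) → ℕ) →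
    0 < lam zero →
    ((i : Fin k) → lam (inject₁ i) < lam (suc i)) →
    lam (fromℕ k) ≤ n →
    ((i : Fin k) → lam (suc i) ≤ lam (inject₁ i) + lam zero) →
    lam zero + lam (fromℕ k) ≡ n →
    (x : Position n) (y η : ℕ) → IsY (UnionOfLevels lam) x y →
    1 ≤ η → η < y →
    ∃ λ x' → Move (UnionOfLevels lam) x x' × minPos x' ≡ minPos x ×
    IsY (UnionOfLevels lam) x' η
lemma6 zero k lam λ₁>0 _ _ _ total _ _ _ _ _ _ =
  contradiction (≤-trans (m≤m+n (lam zero) _) (≤-reflexive total)) (<⇒≱ λ₁>0)
lemma6 (suc n) k lam _ _ _ _ _ x _ zero _ () _
lemma6 (suc n) k lam _ _ _ _ _ x _ (suc v) (zero , _ , refl) _ (s≤s ())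
lemma6 (suc n) k lam _ inc _ gap total x _ (suc v) (suc t , (step mv₀ p , _) , refl) _ η<y =
  let w , mv , tetris-w = Walk.walk H H? (levels-extendable lam inc gap total)
                                    (subConst x (minPos x)) (argmin x) (normalised-argmin x) v
                                    (<-wellFounded _) mv₀ (Plays.play-≤ H (s≤s⁻¹ (s≤s⁻¹ η<y)) p)
  in lift-normalised H x mv tetris-w
  where
  H : Hypergraph (suc n)
  H = UnionOfLevels lam
  H? : ∀ E → Dec (H E)
  H? E = any? (λ j → ∣ E ∣ ≟ lam j)
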